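{- Let $n\ge 2$, let $m\ge 2$ be even with $m/2$ odd, and let $x_1,x_2,\dots,x_m$ be distinct elements of $\{1,\dots,n\}$, so that $(x_1\,x_2),(x_3\,x_4),\dots,(x_{m-1}\,x_m)$ are pairwise disjoint transpositions. Then the subgroup $H=\langle (x_1\,x_2)(x_3\,x_4)\cdots(x_{m-1}\,x_m)\rangle$ of $S_n$ is a perfect code of $S_n$.
   Context: For a group $G$ and a subset $S\subseteq G\setminus\{1_G\}$ with $S=S^{ -1}$, the Cayley graph $\mathrm{Cay}(G,S)$ has vertex set $G$, with $g$ and $h$ adjacent iff $hg^{ -1}\in S$. A perfect code in a graph $\Gamma$ is a subset $C$ of the vertex set such that no two vertices of $C$ are adjacent and every vertex outside $C$ is adjacent to exactly one vertex of $C$. A subgroup $H$ of a group $G$ is a perfect code of $G$ if there exists a Cayley graph $\mathrm{Cay}(G,S)$ of $G$ in which $H$ is a perfect code. -}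

module Defs where

open import Data.Nat using (ℕ; zero; suc)
open import Data.Integer using (ℤ; +_; -[1+_])
open import Data.Fin using (Fin)
open import Data.List using (List; []; _∷_)
open import Data.Product using (Σ; ∃; _×_; _,_)
open import Relation.Nullary using (¬_)
open import Data.Fin.Permutation as P using (Permutation′; _∘ₚ_; flip; transpose)

Perm : ℕ → Set
Perm n = Permutation′ n

module _ {n : ℕ} where

  _≈_ : Perm n → Perm n → Set
  _≈_ = P._≈_

  -- group product  g · h = g ∘ h  (apply h first, then g)
  _·_ : Perm n → Perm n → Perm n
  g · h = h ∘ₚ g

  _⁻¹ : Perm n → Perm n
  g ⁻¹ = flip g

  e : Perm n
  e = P.id

  pow : Perm n → ℕ → Perm n
  pow g zero    = e
  pow g (suc k) = g · pow g k

  zpow : Perm n → ℤ → Perm n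
  zpow g (+ k)      = pow g k
  zpow g -[1+ k ]   = pow (g ⁻¹) (suc k)

  ⟨_⟩ : Perm n → Perm n → Set
  ⟨ t ⟩ g = ∃ λ (k : ℤ) → g ≈ zpow t k

  IsConnectionSet : (Perm n → Set) → Set
  IsConnectionSet S =
      (∀ g h → g ≈ h → S g → S h)
    × (∀ g → S g → ¬ (g ≈ e))
    × (∀ g → S g → S (g ⁻¹))

  Adj : (Perm n → Set) → Perm n → Perm n → Set
  Adj S g h = S (h · (g ⁻¹))

  IsPerfectCodeIn : (Perm n → Set) → (Perm n → Set) → Set
  IsPerfectCodeIn S C =
      (∀ c c' → C c → C c' → ¬ Adj S c c')
    × (∀ g → ¬ C g →
         Σ (Perm n) λ c → C c × Adj S c g ×
           (∀ c' → C c' → Adj S c' g → c' ≈ c))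

  IsPerfectCodeOfSym : (Perm n → Set) → Set₁
  IsPerfectCodeOfSym H =
    Σ (Perm n → Set) λ S → IsConnectionSet S × IsPerfectCodeIn S H

  prodTransp : List (Fin n) → Perm n
  prodTransp (a ∷ b ∷ rest) = transpose a b · prodTransp rest
  prodTransp _              = e

-- t = (x₁ x₂)(x₃ x₄)⋯ is an involution, and it is odd, being a product of m/2
-- transpositions with m/2 odd. Hence H = ⟨t⟩ = {1, t} meets each of the two cosets of
-- the alternating group exactly once, and in Cay(Sₙ, Aₙ ∖ {1}) the two elements of H are
-- not adjacent while every g ∉ H is adjacent to exactly the element of H of its own sign.
--
-- The sign is the parity of the number of inversions, a sum over the pairs i < j in ℤ/2.
-- It is multiplicative because relabelling positions by a permutation only reorients the
-- pairs, and summing a symmetric matrix with zero diagonal over one orientation of each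
-- pair gives the same result in ℤ/2 for every orientation. A transposition is odd since it
-- is conjugate to (0 1), whose only inversion is the pair (0, 1).

module Submission where

open import Defs
open import Algebra.Bundles using (CommutativeRing)
open import Data.Bool.Base using (Bool; true; false; not; _∧_; _xor_)
open import Data.Bool.Properties
  using ( xor-∧-commutativeRing; xor-same; xor-comm; xor-assoc; xor-identityʳ
        ; xor-annihilates-not; ∧-distribˡ-xor; ∧-distribʳ-xor; ∧-zeroʳ
        ; not-injective; not-involutive; ¬-not)
open import Data.Fin.Base using (Fin; zero; suc; punchIn)
open import Data.Fin.Properties using (_≟_; _<?_; <-irrefl; <-cmp; punchInᵢ≢i)
open import Data.Fin.Permutation
  using (_⟨$⟩ʳ_; _⟨$⟩ˡ_; inverseˡ; inverseʳ; transpose; flip)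
open import Data.Integer.Base using (+_; -[1+_])
open import Data.List.Base using (List; []; _∷_; length)
open import Data.List.Relation.Unary.All using (All; []; _∷_)
open import Data.List.Relation.Unary.AllPairs using ([]; _∷_)
open import Data.List.Relation.Unary.Unique.Propositional using (Unique)
open import Data.Nat.Base using (ℕ; zero; suc; _≤_; _/_; _%_; z≤n; s≤s)
open import Data.Nat.DivMod using (m/n≡1+[m∸n]/n)
open import Data.Product.Base using (Σ; _×_; _,_; proj₁; proj₂)
open import Data.Sum.Base using (_⊎_; inj₁; inj₂)
open import Function.Base using (_∘_)
open import Relation.Binary.Definitions using (tri<; tri≈; tri>)
open import Relation.Binary.PropositionalEquality
  using (_≡_; _≢_; refl; sym; trans; cong; cong₂; module ≡-Reasoning)
open import Relation.Nullary using (¬_; does; yes; no)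
open import Relation.Nullary.Decidable using (dec-true; dec-false)
open import Relation.Nullary.Negation using (contradiction)

-- Bool with xor and ∧ is the field ℤ/2; all sums below are taken there.
open import Algebra.Properties.CommutativeMonoid.Sum
  (CommutativeRing.+-commutativeMonoid xor-∧-commutativeRing)
  using ( sum; sum-syntax; sum-cong-≗; ∑-distrib-+; sum-permute; sum-remove
        ; sum-replicate-zero)

open ≡-Reasoning

private
  variable
    n : ℕ

⟨$⟩ʳ-injective : (π : Perm n) → ∀ {i j} → π ⟨$⟩ʳ i ≡ π ⟨$⟩ʳ j → i ≡ j
⟨$⟩ʳ-injective π eq = trans (sym (inverseˡ π)) (trans (cong (π ⟨$⟩ˡ_) eq) (inverseˡ π))

xor≡false⇒≡ : ∀ {x y} → x xor y ≡ false → x ≡ y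
xor≡false⇒≡ {false} refl = refl
xor≡false⇒≡ {true} {true} _ = refl

xor-cancelˡ : ∀ x {y z} → x xor y ≡ x xor z → y ≡ z
xor-cancelˡ false eq = eq
xor-cancelˡ true eq = not-injective eq

xor-telescope : ∀ x y z → (x xor y) xor (y xor z) ≡ x xor z
xor-telescope x y z = begin
  (x xor y) xor (y xor z) ≡⟨ xor-assoc x y (y xor z) ⟩
  x xor (y xor (y xor z)) ≡⟨ cong (x xor_) (sym (xor-assoc y y z)) ⟩
  x xor ((y xor y) xor z) ≡⟨ cong (λ w → x xor (w xor z)) (xor-same y) ⟩
  x xor z                 ∎

sum-zero : (f : Fin n → Bool) → (∀ i → f i ≡ false) → sum f ≡ false
sum-zero {n} f f≡0 = trans (sum-cong-≗ f≡0) (sum-replicate-zero n)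

sum-single : (f : Fin n → Bool) (k : Fin n) → (∀ i → i ≢ k → f i ≡ false) → sum f ≡ f k
sum-single {suc n} f k f≡0 = begin
  sum f                        ≡⟨ sum-remove {i = k} f ⟩
  f k xor sum (f ∘ punchIn k)  ≡⟨ cong (f k xor_) (sum-zero _ λ i → f≡0 _ (punchInᵢ≢i k i)) ⟩
  f k xor false                ≡⟨ xor-identityʳ (f k) ⟩
  f k                          ∎

Matrix : ℕ → Set
Matrix n = Fin n → Fin n → Bool

∑∑ : Matrix n → Bool
∑∑ {n} M = ∑[ i < n ] ∑[ j < n ] M i j

Symmetric : Matrix n → Set
Symmetric M = ∀ i j → M i j ≡ M j i

Hollow : Matrix n → Set
Hollow M = ∀ i → M i i ≡ false

Tournament : Matrix n → Set
Tournament M = ∀ {i j} → i ≢ j → M j i ≡ not (M i j)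

∑∑-cong : {M N : Matrix n} → (∀ i j → M i j ≡ N i j) → ∑∑ M ≡ ∑∑ N
∑∑-cong M≡N = sum-cong-≗ λ i → sum-cong-≗ (M≡N i)

∑∑-xor : (M N : Matrix n) → ∑∑ (λ i j → M i j xor N i j) ≡ ∑∑ M xor ∑∑ N
∑∑-xor M N = trans (sum-cong-≗ λ i → ∑-distrib-+ (M i) (N i))
                   (∑-distrib-+ (λ i → sum (M i)) (λ i → sum (N i)))

∑∑-permute : (M : Matrix n) (π : Perm n) → ∑∑ M ≡ ∑∑ (λ i j → M (π ⟨$⟩ʳ i) (π ⟨$⟩ʳ j))
∑∑-permute M π = trans (sum-cong-≗ λ i → sum-permute (M i) π) (sum-permute _ π)

∑∑-single : (M : Matrix n) (k l : Fin n) → (∀ {i j} → M i j ≡ true → i ≡ k × j ≡ l) →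
            ∑∑ M ≡ M k l
∑∑-single M k l support = begin
  ∑∑ M       ≡⟨ sum-single (λ i → sum (M i)) k (λ i i≢k → sum-zero (M i) λ j → off-row i≢k) ⟩
  sum (M k)  ≡⟨ sum-single (M k) l (λ j j≢l → ¬-not (j≢l ∘ proj₂ ∘ support)) ⟩
  M k l      ∎
  where
  off-row : ∀ {i j} → i ≢ k → M i j ≡ false
  off-row i≢k = ¬-not (i≢k ∘ proj₁ ∘ support)

-- In characteristic 2 the entries above and below the diagonal cancel in pairs.
∑∑-symmetric-hollow : (M : Matrix n) → Symmetric M → Hollow M → ∑∑ M ≡ false
∑∑-symmetric-hollow {zero} M _ _ = refl
∑∑-symmetric-hollow {suc n} M M-sym M-hollow = begin
  (M zero zero xor row) xor ∑[ i < n ] (M (suc i) zero xor ∑[ j < n ] M′ i j)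
    ≡⟨ cong₂ (λ d s → (d xor row) xor s) (M-hollow zero)
             (∑-distrib-+ (λ i → M (suc i) zero) _) ⟩
  row xor (∑[ i < n ] M (suc i) zero xor ∑∑ M′)
    ≡⟨ cong₂ (λ c s → row xor (c xor s)) (sum-cong-≗ λ i → M-sym (suc i) zero)
         (∑∑-symmetric-hollow M′ (λ i j → M-sym (suc i) (suc j)) (M-hollow ∘ suc)) ⟩
  row xor (row xor false)
    ≡⟨ cong (row xor_) (xor-identityʳ row) ⟩
  row xor row
    ≡⟨ xor-same row ⟩
  false ∎
  where
  row : Bool
  row = ∑[ j < n ] M zero (suc j)
  M′ : Matrix n
  M′ i j = M (suc i) (suc j)

∑∑-tournament-invariant : (P Q D : Matrix n) → Tournament P → Tournament Q →
                          Symmetric D → Hollow D →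
                          ∑∑ (λ i j → P i j ∧ D i j) ≡ ∑∑ (λ i j → Q i j ∧ D i j)
∑∑-tournament-invariant P Q D P-tour Q-tour D-sym D-hollow = xor≡false⇒≡ (begin
  ∑∑ (λ i j → P i j ∧ D i j) xor ∑∑ (λ i j → Q i j ∧ D i j)
    ≡⟨ sym (∑∑-xor (λ i j → P i j ∧ D i j) (λ i j → Q i j ∧ D i j)) ⟩
  ∑∑ (λ i j → (P i j ∧ D i j) xor (Q i j ∧ D i j))
    ≡⟨ ∑∑-cong (λ i j → sym (∧-distribʳ-xor (D i j) (P i j) (Q i j))) ⟩
  ∑∑ (λ i j → (P i j xor Q i j) ∧ D i j)
    ≡⟨ ∑∑-symmetric-hollow _ symmetric hollow ⟩
  false ∎)
  where
  hollow : Hollow (λ i j → (P i j xor Q i j) ∧ D i j)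
  hollow i = trans (cong ((P i i xor Q i i) ∧_) (D-hollow i)) (∧-zeroʳ _)

  symmetric : Symmetric (λ i j → (P i j xor Q i j) ∧ D i j)
  symmetric i j with i ≟ j
  ... | yes refl = refl
  ... | no i≢j = cong₂ _∧_
    (sym (trans (cong₂ _xor_ (P-tour i≢j) (Q-tour i≢j)) (xor-annihilates-not (P i j) (Q i j))))
    (D-sym i j)

infix 6 _<ᵇ_

_<ᵇ_ : Fin n → Fin n → Bool
i <ᵇ j = does (i <? j)

<ᵇ-irrefl : (i : Fin n) → i <ᵇ i ≡ false
<ᵇ-irrefl i = dec-false (i <? i) (<-irrefl refl)

<ᵇ-tournament : Tournament (_<ᵇ_ {n})
<ᵇ-tournament {i = i} {j} i≢j with <-cmp i j
... | tri< i<j _ j≮i rewrite dec-true (i <? j) i<j | dec-false (j <? i) j≮i = refl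
... | tri≈ _ i≡j _ = contradiction i≡j i≢j
... | tri> i≮j _ j<i rewrite dec-false (i <? j) i≮j | dec-true (j <? i) j<i = refl

tournament-relabel : {P : Matrix n} (π : Perm n) → Tournament P →
                     Tournament (λ i j → P (π ⟨$⟩ʳ i) (π ⟨$⟩ʳ j))
tournament-relabel π P-tour i≢j = P-tour (i≢j ∘ ⟨$⟩ʳ-injective π)

inverts : Perm n → Matrix n
inverts π i j = (i <ᵇ j) xor ((π ⟨$⟩ʳ i) <ᵇ (π ⟨$⟩ʳ j))

inverts-hollow : (π : Perm n) → Hollow (inverts π)
inverts-hollow π i = cong₂ _xor_ (<ᵇ-irrefl i) (<ᵇ-irrefl (π ⟨$⟩ʳ i))

inverts-symmetric : (π : Perm n) → Symmetric (inverts π)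
inverts-symmetric π i j with i ≟ j
... | yes refl = refl
... | no i≢j = sym (trans
  (cong₂ _xor_ (<ᵇ-tournament i≢j) (<ᵇ-tournament (i≢j ∘ ⟨$⟩ʳ-injective π)))
  (xor-annihilates-not (i <ᵇ j) ((π ⟨$⟩ʳ i) <ᵇ (π ⟨$⟩ʳ j))))

inverts-· : (g h : Perm n) (i j : Fin n) →
            inverts (g · h) i j ≡ inverts h i j xor inverts g (h ⟨$⟩ʳ i) (h ⟨$⟩ʳ j)
inverts-· g h i j =
  sym (xor-telescope (i <ᵇ j) ((h ⟨$⟩ʳ i) <ᵇ (h ⟨$⟩ʳ j)) (((g · h) ⟨$⟩ʳ i) <ᵇ ((g · h) ⟨$⟩ʳ j)))

-- true means odd
sign : Perm n → Bool
sign π = ∑∑ (λ i j → (i <ᵇ j) ∧ inverts π i j)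

-- Relabelling by h turns the pairs i < j into the pairs h⁻¹ i < h⁻¹ j, another
-- orientation of the same unordered pairs.
sign-relabel : (g h : Perm n) →
               ∑∑ (λ i j → (i <ᵇ j) ∧ inverts g (h ⟨$⟩ʳ i) (h ⟨$⟩ʳ j)) ≡ sign g
sign-relabel {n} g h = begin
  ∑∑ (λ i j → (i <ᵇ j) ∧ inverts g (h ⟨$⟩ʳ i) (h ⟨$⟩ʳ j))
    ≡⟨ ∑∑-permute _ (flip h) ⟩
  ∑∑ (λ i j → (h′ i <ᵇ h′ j) ∧ inverts g (h ⟨$⟩ʳ h′ i) (h ⟨$⟩ʳ h′ j))
    ≡⟨ ∑∑-cong (λ i j → cong₂ (λ u v → (h′ i <ᵇ h′ j) ∧ inverts g u v) (inverseʳ h) (inverseʳ h)) ⟩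
  ∑∑ (λ i j → (h′ i <ᵇ h′ j) ∧ inverts g i j)
    ≡⟨ ∑∑-tournament-invariant _ _ _ (tournament-relabel (flip h) <ᵇ-tournament) <ᵇ-tournament
                                     (inverts-symmetric g) (inverts-hollow g) ⟩
  sign g ∎
  where
  h′ : Fin n → Fin n
  h′ = h ⟨$⟩ˡ_

sign-· : (g h : Perm n) → sign (g · h) ≡ sign g xor sign h
sign-· {n} g h = begin
  sign (g · h)
    ≡⟨ ∑∑-cong (λ i j → trans (cong ((i <ᵇ j) ∧_) (inverts-· g h i j))
                             (∧-distribˡ-xor (i <ᵇ j) _ _)) ⟩
  ∑∑ (λ i j → ((i <ᵇ j) ∧ inverts h i j) xor G i j)
    ≡⟨ ∑∑-xor (λ i j → (i <ᵇ j) ∧ inverts h i j) G ⟩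
  sign h xor ∑∑ G
    ≡⟨ cong (sign h xor_) (sign-relabel g h) ⟩
  sign h xor sign g
    ≡⟨ xor-comm (sign h) (sign g) ⟩
  sign g xor sign h ∎
  where
  G : Matrix n
  G i j = (i <ᵇ j) ∧ inverts g (h ⟨$⟩ʳ i) (h ⟨$⟩ʳ j)

sign-cong : (g h : Perm n) → g ≈ h → sign g ≡ sign h
sign-cong _ _ g≈h =
  ∑∑-cong λ i j → cong₂ (λ u v → (i <ᵇ j) ∧ ((i <ᵇ j) xor (u <ᵇ v))) (g≈h i) (g≈h j)

sign-e : sign (e {n}) ≡ false
sign-e {n} = begin
  sign ι             ≡⟨ sign-cong ι (ι · ι) (λ _ → refl) ⟩
  sign (ι · ι)       ≡⟨ sign-· ι ι ⟩
  sign ι xor sign ι  ≡⟨ xor-same (sign ι) ⟩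
  false              ∎
  where
  ι : Perm n
  ι = e

sign-⁻¹ : (g : Perm n) → sign (g ⁻¹) ≡ sign g
sign-⁻¹ {n} g = sym (xor≡false⇒≡ (begin
  sign g xor sign (g ⁻¹)  ≡⟨ sym (sign-· g (g ⁻¹)) ⟩
  sign (g · (g ⁻¹))       ≡⟨ sign-cong (g · (g ⁻¹)) e (λ _ → inverseʳ g) ⟩
  sign (e {n})            ≡⟨ sign-e {n} ⟩
  false                   ∎))

transpose-matchˡ : (i j : Fin n) → transpose i j ⟨$⟩ʳ i ≡ j
transpose-matchˡ i j rewrite dec-true (i ≟ i) refl = refl

transpose-matchʳ : (i j : Fin n) → transpose i j ⟨$⟩ʳ j ≡ i
transpose-matchʳ i j with j ≟ i
... | yes refl = refl
... | no _ rewrite dec-true (j ≟ j) refl = refl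

transpose-other : {i j k : Fin n} → k ≢ i → k ≢ j → transpose i j ⟨$⟩ʳ k ≡ k
transpose-other {i = i} {j} {k} k≢i k≢j
  rewrite dec-false (k ≟ i) k≢i | dec-false (k ≟ j) k≢j = refl

transpose-cases : (i j k : Fin n) → k ≡ i ⊎ k ≡ j ⊎ (k ≢ i × k ≢ j)
transpose-cases i j k with k ≟ i | k ≟ j
... | yes k≡i | _       = inj₁ k≡i
... | no _    | yes k≡j = inj₂ (inj₁ k≡j)
... | no k≢i  | no k≢j  = inj₂ (inj₂ (k≢i , k≢j))

transpose-involutive : (i j : Fin n) → (transpose i j · transpose i j) ≈ e
transpose-involutive i j k with transpose-cases i j k
... | inj₁ refl =
  trans (cong (transpose k j ⟨$⟩ʳ_) (transpose-matchˡ k j)) (transpose-matchʳ k j)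
... | inj₂ (inj₁ refl) =
  trans (cong (transpose i k ⟨$⟩ʳ_) (transpose-matchʳ i k)) (transpose-matchˡ i k)
... | inj₂ (inj₂ (k≢i , k≢j)) =
  trans (cong (transpose i j ⟨$⟩ʳ_) (transpose-other k≢i k≢j)) (transpose-other k≢i k≢j)

transpose-conjugate : (σ : Perm n) (i j : Fin n) →
                      (σ · transpose i j) ≈ (transpose (σ ⟨$⟩ʳ i) (σ ⟨$⟩ʳ j) · σ)
transpose-conjugate σ i j k with transpose-cases i j k
... | inj₁ refl =
  trans (cong (σ ⟨$⟩ʳ_) (transpose-matchˡ k j)) (sym (transpose-matchˡ (σ ⟨$⟩ʳ k) (σ ⟨$⟩ʳ j)))
... | inj₂ (inj₁ refl) =
  trans (cong (σ ⟨$⟩ʳ_) (transpose-matchʳ i k)) (sym (transpose-matchʳ (σ ⟨$⟩ʳ i) (σ ⟨$⟩ʳ k)))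
... | inj₂ (inj₂ (k≢i , k≢j)) = trans (cong (σ ⟨$⟩ʳ_) (transpose-other k≢i k≢j))
  (sym (transpose-other (k≢i ∘ ⟨$⟩ʳ-injective σ) (k≢j ∘ ⟨$⟩ʳ-injective σ)))

sign-transpose-relabel : (σ : Perm n) (i j : Fin n) →
                         sign (transpose (σ ⟨$⟩ʳ i) (σ ⟨$⟩ʳ j)) ≡ sign (transpose i j)
sign-transpose-relabel {n} σ i j = xor-cancelˡ (sign σ) (begin
  sign σ xor sign τ′  ≡⟨ xor-comm (sign σ) (sign τ′) ⟩
  sign τ′ xor sign σ  ≡⟨ sym (sign-· τ′ σ) ⟩
  sign (τ′ · σ)       ≡⟨ sign-cong (τ′ · σ) (σ · τ) (sym ∘ transpose-conjugate σ i j) ⟩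
  sign (σ · τ)        ≡⟨ sign-· σ τ ⟩
  sign σ xor sign τ   ∎)
  where
  τ τ′ : Perm n
  τ = transpose i j
  τ′ = transpose (σ ⟨$⟩ʳ i) (σ ⟨$⟩ʳ j)

sign-transpose₀₁ : sign (transpose {suc (suc n)} zero (suc zero)) ≡ true
sign-transpose₀₁ {n} = ∑∑-single (λ i j → (i <ᵇ j) ∧ inverts τ i j) zero (suc zero) support
  where
  τ : Perm (suc (suc n))
  τ = transpose zero (suc zero)

  support : ∀ {i j} → (i <ᵇ j) ∧ inverts τ i j ≡ true → i ≡ zero × j ≡ suc zero
  support {zero} {suc zero} _ = refl , refl
  support {zero} {zero} ()
  support {zero} {suc (suc j)} ()
  support {suc zero} {zero} ()
  support {suc zero} {suc zero} ()
  support {suc zero} {suc (suc j)} ()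
  support {suc (suc i)} {zero} ()
  support {suc (suc i)} {suc zero} ()
  support {suc (suc i)} {suc (suc j)} eq = contradiction
    (trans (sym eq) (trans (cong (i<j ∧_) (xor-same i<j)) (∧-zeroʳ i<j))) λ ()
    where
    i<j : Bool
    i<j = suc (suc i) <ᵇ suc (suc j)

sign-transpose : {i j : Fin n} → i ≢ j → sign (transpose i j) ≡ true
sign-transpose {suc zero} {zero} {zero} 0≢0 = contradiction refl 0≢0
sign-transpose {suc (suc n)} {a} {b} a≢b = begin
  sign (transpose a b)
    ≡⟨ cong₂ (λ x y → sign (transpose x y)) (sym σ0≡a) (sym σ1≡b) ⟩
  sign (transpose (σ ⟨$⟩ʳ zero) (σ ⟨$⟩ʳ suc zero))
    ≡⟨ sign-transpose-relabel σ zero (suc zero) ⟩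
  sign (transpose {suc (suc n)} zero (suc zero))
    ≡⟨ sign-transpose₀₁ {n} ⟩
  true ∎
  where
  c : Fin (suc (suc n))
  c = transpose zero a ⟨$⟩ʳ b
  σ : Perm (suc (suc n))
  σ = transpose zero a · transpose (suc zero) c
  c≢0 : c ≢ zero
  c≢0 c≡0 = a≢b (sym (begin
    b                           ≡⟨ sym (transpose-involutive zero a b) ⟩
    transpose zero a ⟨$⟩ʳ c     ≡⟨ cong (transpose zero a ⟨$⟩ʳ_) c≡0 ⟩
    transpose zero a ⟨$⟩ʳ zero  ≡⟨ transpose-matchˡ zero a ⟩
    a                           ∎))
  σ0≡a : σ ⟨$⟩ʳ zero ≡ a
  σ0≡a = trans (cong (transpose zero a ⟨$⟩ʳ_) (transpose-other {i = suc zero} (λ ()) (c≢0 ∘ sym)))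
               (transpose-matchˡ zero a)
  σ1≡b : σ ⟨$⟩ʳ suc zero ≡ b
  σ1≡b = trans (cong (transpose zero a ⟨$⟩ʳ_) (transpose-matchˡ (suc zero) c))
               (transpose-involutive zero a b)

prodTransp-fixes : {x : Fin n} (xs : List (Fin n)) → All (x ≢_) xs → prodTransp xs ⟨$⟩ʳ x ≡ x
prodTransp-fixes []          _                  = refl
prodTransp-fixes (_ ∷ [])    _                  = refl
prodTransp-fixes (a ∷ b ∷ r) (x≢a ∷ x≢b ∷ x∉r) =
  trans (cong (transpose a b ⟨$⟩ʳ_) (prodTransp-fixes r x∉r)) (transpose-other x≢a x≢b)

fixed-commutes-with-transpose : (π : Perm n) {a b : Fin n} → π ⟨$⟩ʳ a ≡ a → π ⟨$⟩ʳ b ≡ b →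
                                (π · transpose a b) ≈ (transpose a b · π)
fixed-commutes-with-transpose π πa≡a πb≡b k = trans (transpose-conjugate π _ _ k)
  (cong₂ (λ u v → transpose u v ⟨$⟩ʳ (π ⟨$⟩ʳ k)) πa≡a πb≡b)

prodTransp-involutive : (xs : List (Fin n)) → Unique xs → (prodTransp xs · prodTransp xs) ≈ e
prodTransp-involutive []          _ _ = refl
prodTransp-involutive (_ ∷ [])    _ _ = refl
prodTransp-involutive (a ∷ b ∷ r) ((_ ∷ a∉r) ∷ (b∉r ∷ r-unique)) x = begin
  τ (ρ (τ (ρ x)))  ≡⟨ cong τ (ρτ≈τρ (ρ x)) ⟩
  τ (τ (ρ (ρ x)))  ≡⟨ transpose-involutive a b (ρ (ρ x)) ⟩
  ρ (ρ x)          ≡⟨ prodTransp-involutive r r-unique x ⟩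
  x                ∎
  where
  τ ρ : Fin _ → Fin _
  τ = transpose a b ⟨$⟩ʳ_
  ρ = prodTransp r ⟨$⟩ʳ_
  ρτ≈τρ : (prodTransp r · transpose a b) ≈ (transpose a b · prodTransp r)
  ρτ≈τρ = fixed-commutes-with-transpose (prodTransp r)
            (prodTransp-fixes r a∉r) (prodTransp-fixes r b∉r)

isOdd : ℕ → Bool
isOdd zero    = false
isOdd (suc k) = not (isOdd k)

%2≡1⇒isOdd : ∀ k → k % 2 ≡ 1 → isOdd k ≡ true
%2≡1⇒isOdd (suc zero)    _      = refl
%2≡1⇒isOdd (suc (suc k)) k%2≡1 = trans (not-involutive (isOdd k)) (%2≡1⇒isOdd k k%2≡1)

sign-prodTransp : (xs : List (Fin n)) → Unique xs → sign (prodTransp xs) ≡ isOdd (length xs / 2)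
sign-prodTransp {n} []       _ = sign-e {n}
sign-prodTransp {n} (_ ∷ []) _ = sign-e {n}
sign-prodTransp (a ∷ b ∷ r) ((a≢b ∷ _) ∷ (_ ∷ r-unique)) = begin
  sign (transpose a b · prodTransp r)
    ≡⟨ sign-· (transpose a b) (prodTransp r) ⟩
  sign (transpose a b) xor sign (prodTransp r)
    ≡⟨ cong₂ _xor_ (sign-transpose a≢b) (sign-prodTransp r r-unique) ⟩
  isOdd (suc (length r / 2))
    ≡⟨ cong isOdd (sym (m/n≡1+[m∸n]/n {length (a ∷ b ∷ r)} (s≤s (s≤s z≤n)))) ⟩
  isOdd (length (a ∷ b ∷ r) / 2) ∎

·⁻¹≈e⇒≈ : (g c : Perm n) → (g · (c ⁻¹)) ≈ e → g ≈ c
·⁻¹≈e⇒≈ g c gc⁻¹≈e x = trans (cong (g ⟨$⟩ʳ_) (sym (inverseˡ c))) (gc⁻¹≈e (c ⟨$⟩ʳ x))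

≈⇒·⁻¹≈e : (g c : Perm n) → g ≈ c → (g · (c ⁻¹)) ≈ e
≈⇒·⁻¹≈e _ c g≈c x = trans (g≈c (c ⟨$⟩ˡ x)) (inverseʳ c)

sign-·⁻¹ : (g c : Perm n) → sign (g · (c ⁻¹)) ≡ sign g xor sign c
sign-·⁻¹ g c = trans (sign-· g (c ⁻¹)) (cong (sign g xor_) (sign-⁻¹ c))

NontrivialEven : Perm n → Set
NontrivialEven g = sign g ≡ false × ¬ g ≈ e

nontrivialEven-isConnectionSet : IsConnectionSet (NontrivialEven {n})
nontrivialEven-isConnectionSet = respects-≈ , (λ _ → proj₂) , closed-⁻¹
  where
  respects-≈ : ∀ g h → g ≈ h → NontrivialEven g → NontrivialEven h
  respects-≈ g h g≈h (even , g≉e) =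
    trans (sym (sign-cong g h g≈h)) even , λ h≈e → g≉e λ i → trans (g≈h i) (h≈e i)
  closed-⁻¹ : ∀ g → NontrivialEven g → NontrivialEven (g ⁻¹)
  closed-⁻¹ g (even , g≉e) =
    trans (sign-⁻¹ g) even , λ g⁻¹≈e → g≉e λ i → sym (·⁻¹≈e⇒≈ e g g⁻¹≈e i)

adjacent⇒sign≡ : (c g : Perm n) → Adj NontrivialEven c g → sign g ≡ sign c
adjacent⇒sign≡ c g (even , _) = xor≡false⇒≡ (trans (sym (sign-·⁻¹ g c)) even)

sign≡⇒adjacent : (c g : Perm n) → sign g ≡ sign c → ¬ g ≈ c → Adj NontrivialEven c g
sign≡⇒adjacent c g sg≡sc g≉c =
  trans (sign-·⁻¹ g c) (trans (cong (_xor sign c) sg≡sc) (xor-same (sign c))) , g≉c ∘ ·⁻¹≈e⇒≈ g c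

-- H is a complement of the alternating group.
record IsSignTransversal (H : Perm n → Set) : Set where
  field
    ≈-closed        : {g h : Perm n} → g ≈ h → H g → H h
    sign-injective  : {c c′ : Perm n} → H c → H c′ → sign c ≡ sign c′ → c ≈ c′
    sign-surjective : (b : Bool) → Σ (Perm n) λ c → H c × sign c ≡ b

signTransversal⇒perfectCode : {H : Perm n → Set} → IsSignTransversal H → IsPerfectCodeOfSym H
signTransversal⇒perfectCode {n} {H} H-transversal =
  NontrivialEven , nontrivialEven-isConnectionSet , independent , dominating
  where
  open IsSignTransversal H-transversal

  independent : ∀ c c′ → H c → H c′ → ¬ Adj NontrivialEven c c′
  independent c c′ Hc Hc′ adj =
    proj₂ adj (≈⇒·⁻¹≈e c′ c (sign-injective Hc′ Hc (adjacent⇒sign≡ c c′ adj)))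

  dominating : ∀ g → ¬ H g → Σ (Perm n) λ c → H c × Adj NontrivialEven c g ×
                                (∀ c′ → H c′ → Adj NontrivialEven c′ g → c′ ≈ c)
  dominating g g∉H with sign-surjective (sign g)
  ... | c , Hc , sc≡sg =
    c , Hc , sign≡⇒adjacent c g (sym sc≡sg) (λ g≈c → g∉H (≈-closed (λ i → sym (g≈c i)) Hc)) ,
    λ c′ Hc′ adj → sign-injective Hc′ Hc (trans (sym (adjacent⇒sign≡ c′ g adj)) (sym sc≡sg))

pow-involution : (t u : Perm n) → (t · t) ≈ e → u ≈ t → ∀ k → pow u k ≈ e ⊎ pow u k ≈ t
pow-involution t u t² u≈t zero = inj₁ λ _ → refl
pow-involution t u t² u≈t (suc k) with pow-involution t u t² u≈t k
... | inj₁ uᵏ≈e = inj₂ λ x → trans (cong (u ⟨$⟩ʳ_) (uᵏ≈e x)) (u≈t x)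
... | inj₂ uᵏ≈t = inj₁ λ x → trans (cong (u ⟨$⟩ʳ_) (uᵏ≈t x)) (trans (u≈t _) (t² x))

involution-⁻¹ : (t : Perm n) → (t · t) ≈ e → (t ⁻¹) ≈ t
involution-⁻¹ t t² x = trans (cong (t ⟨$⟩ˡ_) (sym (t² x))) (inverseˡ t)

involution-cyclic : (t g : Perm n) → (t · t) ≈ e → ⟨ t ⟩ g → g ≈ e ⊎ g ≈ t
involution-cyclic t g t² (k , g≈tᵏ) with powers k
  where
  powers : ∀ k → zpow t k ≈ e ⊎ zpow t k ≈ t
  powers (+ k)    = pow-involution t t t² (λ _ → refl) k
  powers -[1+ k ] = pow-involution t (t ⁻¹) t² (involution-⁻¹ t t²) (suc k)
... | inj₁ tᵏ≈e = inj₁ λ i → trans (g≈tᵏ i) (tᵏ≈e i)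
... | inj₂ tᵏ≈t = inj₂ λ i → trans (g≈tᵏ i) (tᵏ≈t i)

oddInvolution-signTransversal : (t : Perm n) → (t · t) ≈ e → sign t ≡ true →
                                IsSignTransversal ⟨ t ⟩
oddInvolution-signTransversal {n} t t² t-odd = record
  { ≈-closed        = λ { g≈h (k , g≈tᵏ) → k , λ i → trans (sym (g≈h i)) (g≈tᵏ i) }
  ; sign-injective  = λ {c} {c′} → injective c c′
  ; sign-surjective = surjective
  }
  where
  sign-cases : (c : Perm n) → ⟨ t ⟩ c → c ≈ e × sign c ≡ false ⊎ c ≈ t × sign c ≡ true
  sign-cases c Hc with involution-cyclic t c t² Hc
  ... | inj₁ c≈e = inj₁ (c≈e , trans (sign-cong c e c≈e) (sign-e {n}))
  ... | inj₂ c≈t = inj₂ (c≈t , trans (sign-cong c t c≈t) t-odd)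

  injective : (c c′ : Perm n) → ⟨ t ⟩ c → ⟨ t ⟩ c′ → sign c ≡ sign c′ → c ≈ c′
  injective c c′ Hc Hc′ sc≡sc′ with sign-cases c Hc | sign-cases c′ Hc′
  ... | inj₁ (c≈e , _) | inj₁ (c′≈e , _) = λ i → trans (c≈e i) (sym (c′≈e i))
  ... | inj₂ (c≈t , _) | inj₂ (c′≈t , _) = λ i → trans (c≈t i) (sym (c′≈t i))
  ... | inj₁ (_ , even) | inj₂ (_ , odd)  = contradiction (trans (sym even) (trans sc≡sc′ odd)) λ ()
  ... | inj₂ (_ , odd)  | inj₁ (_ , even) = contradiction (trans (sym odd) (trans sc≡sc′ even)) λ ()

  surjective : (b : Bool) → Σ (Perm n) λ c → ⟨ t ⟩ c × sign c ≡ b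
  surjective false = e , (+ 0 , λ _ → refl) , sign-e {n}
  surjective true  = t , (+ 1 , λ _ → refl) , t-odd

theorem2 : (n m : ℕ) → 2 ≤ n → 2 ≤ m → m % 2 ≡ 0 → (m / 2) % 2 ≡ 1 →
    (xs : List (Fin n)) → length xs ≡ m → Unique xs →
    IsPerfectCodeOfSym ⟨ prodTransp xs ⟩
theorem2 _ _ _ _ _ m/2-odd xs refl xs-unique =
  signTransversal⇒perfectCode (oddInvolution-signTransversal (prodTransp xs)
    (prodTransp-involutive xs xs-unique)
    (trans (sign-prodTransp xs xs-unique) (%2≡1⇒isOdd (length xs / 2) m/2-odd)))
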